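{- For every formula $\varphi$ of propositional linear temporal logic, $\mathrm{LTL} \models \neg \Box (\varphi\leftrightarrow\bigcirc\diamondsuit\neg\varphi)$.
   Context: Propositional linear temporal logic (LTL) over a set $\mathbf{V}$ of propositional constants, with formulas built from $\mathbf{V}$, $\mathbf{false}$, $\rightarrow$, the "next" operator $\bigcirc$ and the "always" operator $\Box$; $\diamondsuit\varphi$ ("sometime") abbreviates $\neg\Box\neg\varphi$. A temporal (Kripke) structure is an infinite sequence $\mathcal{K}=(\eta_0,\eta_1,\dots)$ of valuations $\eta_i:\mathbf{V}\to\{\mathfrak{ff},\mathfrak{tt}\}$, with $\mathcal{K}_i(v)=\eta_i(v)$, classical clauses for the connectives, $\mathcal{K}_i(\bigcirc\varphi)=\mathcal{K}_{i+1}(\varphi)$, and $\mathcal{K}_i(\Box\varphi)=\mathfrak{tt}$ iff $\mathcal{K}_j(\varphi)=\mathfrak{tt}$ for all $j\ge i$. $\mathrm{LTL}\models\varphi$ means $\mathcal{K}_i(\varphi)=\mathfrak{tt}$ for every temporal structure $\mathcal{K}$ and every $i\in\mathbb{N}$. -}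

module Defs where

open import Data.Nat using (ℕ; suc; _≥_)
open import Data.Bool using (Bool; true)
open import Data.Empty using (⊥)
open import Relation.Binary.PropositionalEquality using (_≡_)

data Formula (V : Set) : Set where
  var   : V → Formula V
  false : Formula V
  _⇒_   : Formula V → Formula V → Formula V
  ○_    : Formula V → Formula V
  □_    : Formula V → Formula V

infixr 5 _⇒_
infix 7 ○_ □_ ¬ᶠ_ ◇_

¬ᶠ_ : ∀ {V} → Formula V → Formula V
¬ᶠ φ = φ ⇒ false

_∧ᶠ_ : ∀ {V} → Formula V → Formula V → Formula V
φ ∧ᶠ ψ = ¬ᶠ (φ ⇒ ¬ᶠ ψ)

_⇔_ : ∀ {V} → Formula V → Formula V → Formula V
φ ⇔ ψ = (φ ⇒ ψ) ∧ᶠ (ψ ⇒ φ)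

◇_ : ∀ {V} → Formula V → Formula V
◇ φ = ¬ᶠ (□ (¬ᶠ φ))

Structure : Set → Set
Structure V = ℕ → V → Bool

_,_⊨_ : ∀ {V} → Structure V → ℕ → Formula V → Set
K , i ⊨ var v   = K i v ≡ true
K , i ⊨ false   = ⊥
K , i ⊨ (φ ⇒ ψ) = K , i ⊨ φ → K , i ⊨ ψ
K , i ⊨ (○ φ)   = K , suc i ⊨ φ
K , i ⊨ (□ φ)   = ∀ j → j ≥ i → K , j ⊨ φ

Valid : ∀ {V} → Formula V → Set
Valid {V} φ = (K : Structure V) (i : ℕ) → K , i ⊨ φ

module Submission where

-- Suppose □(φ ⇔ ○◇¬φ) held from state i on, and write P j for
-- "φ holds at j".  Since ◇¬φ unfolds to ¬ □ ¬¬φ, the hypothesis says that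
-- from i on, P j holds exactly when it is not the case that P is ¬¬-true
-- everywhere after j: a sequence that denies its own future.  Such a
-- sequence cannot exist, and the argument is constructive:
--   * if the future of some j ≥ i were ¬¬P everywhere, then ¬¬P (j+1), and
--     P (j+1) denies its own future, which is part of that of j; so no
--     future after a state j ≥ i is ¬¬P everywhere;
--   * hence, by the converse direction, ¬¬P j for every j ≥ i, which makes
--     the future after i ¬¬P everywhere, contradicting the first point.

open import Defs
open import Data.Nat using (ℕ; suc; _≥_)
open import Data.Nat.Properties using (≤-refl; ≤-trans; n≤1+n; m≤n⇒m≤1+n)
open import Data.Empty using (⊥)
open import Relation.Nullary using (¬_)

-- "From k on, P never definitely fails": the meaning of □¬¬φ at k,
-- whose negation is the meaning of ◇¬φ at k.
NeverFailsFrom : (ℕ → Set) → ℕ → Set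
NeverFailsFrom P k = ∀ m → m ≥ k → ¬ ¬ P m

-- A predicate that, from i on, holds exactly when it fails somewhere later
-- (in the weak, doubly negated sense forced by constructive logic) is
-- impossible.
no-self-denying-sequence :
  (P : ℕ → Set) (i : ℕ) →
  (∀ j → j ≥ i → P j → ¬ NeverFailsFrom P (suc j)) →
  (∀ j → j ≥ i → ¬ NeverFailsFrom P (suc j) → ¬ ¬ P j) →
  ⊥
no-self-denying-sequence P i denies affirms =
  futureFails i ≤-refl (λ m m≥ → neverFails m (≤-trans (n≤1+n i) m≥))
  where
  futureFails : ∀ j → j ≥ i → ¬ NeverFailsFrom P (suc j)
  futureFails j j≥i never = never (suc j) ≤-refl λ p →
    denies (suc j) (m≤n⇒m≤1+n j≥i) p
      (λ m m≥ → never m (≤-trans (n≤1+n (suc j)) m≥))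

  neverFails : NeverFailsFrom P i
  neverFails j j≥i = affirms j j≥i (futureFails j j≥i)

-- The two directions of ⇔ at a single state, in the form available
-- constructively (the encoding of ∧ only yields doubly negated components).
-- (φ and ψ are explicit: they cannot be inferred from K , j ⊨ _.)
⇔-left : ∀ {V} {K : Structure V} {j : ℕ} (φ ψ : Formula V) →
  K , j ⊨ (φ ⇔ ψ) → K , j ⊨ φ → ¬ ¬ (K , j ⊨ ψ)
⇔-left _ _ iff p notψ = iff λ φ⇒ψ _ → notψ (φ⇒ψ p)

⇔-right : ∀ {V} {K : Structure V} {j : ℕ} (φ ψ : Formula V) →
  K , j ⊨ (φ ⇔ ψ) → K , j ⊨ ψ → ¬ ¬ (K , j ⊨ φ)
⇔-right _ _ iff q notφ = iff λ _ ψ⇒φ → notφ (ψ⇒φ q)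

-- With P j = (K , j ⊨ φ), the formula ○◇¬φ at j means exactly
-- ¬ NeverFailsFrom P (suc j), so the hypothesis □(φ ⇔ ○◇¬φ) at i supplies
-- both directions required by no-self-denying-sequence.
theorem4p1 : (V : Set) (φ : Formula V) → Valid (¬ᶠ (□ (φ ⇔ (○ (◇ (¬ᶠ φ))))))
theorem4p1 V φ K i always =
  no-self-denying-sequence (λ j → K , j ⊨ φ) i
    (λ j j≥i p never → ⇔-left φ ψ (always j j≥i) p (λ ◇¬φ → ◇¬φ never))
    (λ j j≥i ◇¬φ → ⇔-right φ ψ (always j j≥i) ◇¬φ)
  where
  ψ : Formula V
  ψ = ○ (◇ (¬ᶠ φ))
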